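{- Let $\mathbf{w}_1=1$, $\mathbf{w}_2=\tfrac12+\tfrac{\sqrt3}{2}\mathbf{j}$, $\mathbf{w}_3=\tfrac12+\tfrac{\sqrt3}{6}\mathbf{j}+\tfrac{\sqrt6}{3}\mathbf{k}$, $\mathbf{w}_4=\tfrac{\sqrt2}{2}\mathbf{i}+\tfrac{\sqrt3}{3}\mathbf{j}+\tfrac{\sqrt6}{6}\mathbf{k}$, and $H_{2,3,6}=\mathbb{Z}[\mathbf{w}_1,\mathbf{w}_2,\mathbf{w}_3,\mathbf{w}_4]$. Then $H_{2,3,6}$ is closed under quaternion multiplication and is an order in the quaternion algebra $\left(\frac{ -2,-3}{\mathbb{Q}}\right)$.
   Context: Real quaternions with $\mathbf{i}^2=\mathbf{j}^2=\mathbf{k}^2=\mathbf{i}\mathbf{j}\mathbf{k}=-1$; $\mathbb{Z}[\cdots]$ denotes the $\mathbb{Z}$-module of integer linear combinations of the listed quaternions. For negative rationals $m,n$, the quaternion algebra $\left(\frac{m,n}{\mathbb{Q}}\right)$ (generators $\hat{\mathbf{i}},\hat{\mathbf{j}}$ with $\hat{\mathbf{i}}^2=m$, $\hat{\mathbf{j}}^2=n$, $\hat{\mathbf{k}}=\hat{\mathbf{i}}\hat{\mathbf{j}}=-\hat{\mathbf{j}}\hat{\mathbf{i}}$) is identified with its image in the real quaternions under $a_1+a_2\hat{\mathbf{i}}+a_3\hat{\mathbf{j}}+a_4\hat{\mathbf{k}}\mapsto a_1+a_2\sqrt{ -m}\,\mathbf{i}+a_3\sqrt{ -n}\,\mathbf{j}+a_4\sqrt{mn}\,\mathbf{k}$.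 An order of this algebra is a finitely generated $\mathbb{Z}$-module $H$ contained in it that is a ring with unity and whose $\mathbb{Q}$-span is the whole algebra. -}

module Defs where

open import Data.Nat using (ℕ)
open import Data.Integer as ℤ using (ℤ; +_; -[1+_])
open import Data.Rational using (ℚ; _+_; _*_; -_; _-_; _/_; 0ℚ; 1ℚ)
open import Data.Vec using (Vec; []; _∷_)
open import Data.Product using (Σ; ∃; _×_; _,_)
open import Relation.Binary.PropositionalEquality using (_≡_)
open import Function.Bundles using (_⇔_)

-- Elements a₁ + a₂ î + a₃ ĵ + a₄ k̂ of the quaternion algebra (m,n / ℚ),
-- stored by their rational coordinates in the basis 1, î, ĵ, k̂.
record Quat : Set where
  constructor ⟨_,_,_,_⟩
  field
    c₁ c₂ c₃ c₄ : ℚ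

open Quat public

ι : ℤ → ℚ
ι z = z / 1

zeroQ : Quat
zeroQ = ⟨ 0ℚ , 0ℚ , 0ℚ , 0ℚ ⟩

oneQ : Quat
oneQ = ⟨ 1ℚ , 0ℚ , 0ℚ , 0ℚ ⟩

_⊕_ : Quat → Quat → Quat
⟨ a₁ , a₂ , a₃ , a₄ ⟩ ⊕ ⟨ b₁ , b₂ , b₃ , b₄ ⟩ = ⟨ a₁ + b₁ , a₂ + b₂ , a₃ + b₃ , a₄ + b₄ ⟩

_·_ : ℚ → Quat → Quat
r · ⟨ a₁ , a₂ , a₃ , a₄ ⟩ = ⟨ r * a₁ , r * a₂ , r * a₃ , r * a₄ ⟩

-- multiplication in (m,n / ℚ): î² = m, ĵ² = n, k̂ = îĵ = -ĵî (so k̂² = -mn,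
-- ĵk̂ = -n î, k̂ĵ = n î, îk̂ = m ĵ, k̂î = -m ĵ).
mulQ : (m n : ℚ) → Quat → Quat → Quat
mulQ m n ⟨ a₁ , a₂ , a₃ , a₄ ⟩ ⟨ b₁ , b₂ , b₃ , b₄ ⟩ =
  ⟨ a₁ * b₁ + m * (a₂ * b₂) + n * (a₃ * b₃) - (m * n) * (a₄ * b₄)
  , a₁ * b₂ + a₂ * b₁ - n * (a₃ * b₄) + n * (a₄ * b₃)
  , a₁ * b₃ + a₃ * b₁ + m * (a₂ * b₄) - m * (a₄ * b₂)
  , a₁ * b₄ + a₄ * b₁ + a₂ * b₃ - a₃ * b₂ ⟩

lincomb : ∀ {k} → Vec ℚ k → Vec Quat k → Quat
lincomb [] [] = zeroQ
lincomb (c ∷ cs) (g ∷ gs) = (c · g) ⊕ lincomb cs gs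

zlincomb : ∀ {k} → Vec ℤ k → Vec Quat k → Quat
zlincomb [] [] = zeroQ
zlincomb (z ∷ zs) (g ∷ gs) = (ι z · g) ⊕ zlincomb zs gs

ZSpan : ∀ {k} → Vec Quat k → Quat → Set
ZSpan {k} gs x = Σ (Vec ℤ k) λ zs → x ≡ zlincomb zs gs

AllIn : (Quat → Set) → ∀ {k} → Vec Quat k → Set
AllIn H [] = Data.Unit.⊤ where import Data.Unit
AllIn H (g ∷ gs) = H g × AllIn H gs

record IsOrder (m n : ℚ) (H : Quat → Set) : Set where
  field
    finitelyGenerated : Σ ℕ λ k → Σ (Vec Quat k) λ gs → ∀ x → H x ⇔ ZSpan gs x
    hasOne            : H oneQ
    mulClosed         : ∀ x y → H x → H y → H (mulQ m n x y)
    spansAlgebra      : ∀ x → Σ ℕ λ k → Σ (Vec Quat k) λ gs → AllIn H gs ×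
                          Σ (Vec ℚ k) λ cs → x ≡ lincomb cs gs

-- the generators, in the basis 1, î, ĵ, k̂ of (-2,-3 / ℚ), where
-- î ↦ √2 i, ĵ ↦ √3 j, k̂ ↦ √6 k:
-- w₁ = 1, w₂ = 1/2 + 1/2 ĵ, w₃ = 1/2 + 1/6 ĵ + 1/3 k̂, w₄ = 1/2 î + 1/3 ĵ + 1/6 k̂
w₁ w₂ w₃ w₄ : Quat
w₁ = ⟨ 1ℚ , 0ℚ , 0ℚ , 0ℚ ⟩
w₂ = ⟨ + 1 / 2 , 0ℚ , + 1 / 2 , 0ℚ ⟩
w₃ = ⟨ + 1 / 2 , 0ℚ , + 1 / 6 , + 1 / 3 ⟩
w₄ = ⟨ 0ℚ , + 1 / 2 , + 1 / 3 , + 1 / 6 ⟩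

m₀ n₀ : ℚ
m₀ = - 1ℚ - 1ℚ
n₀ = - 1ℚ - 1ℚ - 1ℚ

H₂₃₆ : Quat → Set
H₂₃₆ = ZSpan (w₁ ∷ w₂ ∷ w₃ ∷ w₄ ∷ [])

-- Quaternion multiplication in (m,n / ℚ) is ℚ-bilinear, so the ℤ-span of w₁, …, w₄ is closed
-- under it as soon as each of the sixteen products wᵢ wⱼ is an integral combination of the wⱼ.
-- The span contains 1 = w₁, and it contains 1, 3î, ĵ, k̂, which is a ℚ-basis of the algebra.
module Submission where

open import Defs
open import Algebra.Bundles using (CommutativeMonoid)
import Algebra.Properties.CommutativeSemigroup as CommSemigroupProperties
open import Data.Fin using (#_)
open import Data.Integer as ℤ using (ℤ; +_; 0ℤ; 1ℤ; -1ℤ)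
import Data.Integer.Properties as ℤ
open import Data.Nat using (ℕ)
open import Data.Product using (Σ; _×_; _,_)
open import Data.Rational as ℚ using (ℚ; 0ℚ; 1ℚ; _+_; _*_; -_; _/_; toℚᵘ)
import Data.Rational.Properties as ℚ
open import Data.Rational.Solver using (module +-*-Solver)
import Data.Rational.Unnormalised as ℚᵘ
import Data.Rational.Unnormalised.Properties as ℚᵘ
open import Data.Unit using (tt)
open import Data.Vec using (Vec; []; _∷_; zipWith; map; replicate)
open import Function using (id)
open import Function.Bundles using (mk⇔)
open import Relation.Binary.PropositionalEquality
open +-*-Solver using (Polynomial; var; con; _:+_; _:*_; _:-_; ⟦_⟧; ⟦_⟧↓; prove)

quat-cong : ∀ {a₁ a₂ a₃ a₄ b₁ b₂ b₃ b₄ : ℚ} → a₁ ≡ b₁ → a₂ ≡ b₂ → a₃ ≡ b₃ → a₄ ≡ b₄ →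
            ⟨ a₁ , a₂ , a₃ , a₄ ⟩ ≡ ⟨ b₁ , b₂ , b₃ , b₄ ⟩
quat-cong refl refl refl refl = refl

toℚᵘ-ι : ∀ z → toℚᵘ (ι z) ℚᵘ.≃ ℚᵘ.mkℚᵘ z 0
toℚᵘ-ι z = ℚ.toℚᵘ-fromℚᵘ (ℚᵘ.mkℚᵘ z 0)

ι-homo-+ : ∀ a b → ι (a ℤ.+ b) ≡ ι a + ι b
ι-homo-+ a b = ℚ.toℚᵘ-injective (begin
  toℚᵘ (ι (a ℤ.+ b))            ≈⟨ toℚᵘ-ι _ ⟩
  ℚᵘ.mkℚᵘ (a ℤ.+ b) 0           ≈⟨ ℚᵘ.*≡* (cong (ℤ._* 1ℤ) (cong₂ ℤ._+_ (sym (ℤ.*-identityʳ a))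
                                                                    (sym (ℤ.*-identityʳ b)))) ⟩
  ℚᵘ.mkℚᵘ a 0 ℚᵘ.+ ℚᵘ.mkℚᵘ b 0  ≈⟨ ℚᵘ.+-cong (ℚᵘ.≃-sym (toℚᵘ-ι a)) (ℚᵘ.≃-sym (toℚᵘ-ι b)) ⟩
  toℚᵘ (ι a) ℚᵘ.+ toℚᵘ (ι b)    ≈⟨ ℚ.toℚᵘ-homo-+ (ι a) (ι b) ⟨
  toℚᵘ (ι a + ι b)              ∎)
  where open ℚᵘ.≃-Reasoning

ι-homo-* : ∀ a b → ι (a ℤ.* b) ≡ ι a * ι b
ι-homo-* a b = ℚ.toℚᵘ-injective (begin
  toℚᵘ (ι (a ℤ.* b))            ≈⟨ toℚᵘ-ι _ ⟩
  ℚᵘ.mkℚᵘ (a ℤ.* b) 0           ≈⟨ ℚᵘ.*≡* refl ⟩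
  ℚᵘ.mkℚᵘ a 0 ℚᵘ.* ℚᵘ.mkℚᵘ b 0  ≈⟨ ℚᵘ.*-cong (ℚᵘ.≃-sym (toℚᵘ-ι a)) (ℚᵘ.≃-sym (toℚᵘ-ι b)) ⟩
  toℚᵘ (ι a) ℚᵘ.* toℚᵘ (ι b)    ≈⟨ ℚ.toℚᵘ-homo-* (ι a) (ι b) ⟨
  toℚᵘ (ι a * ι b)              ∎)
  where open ℚᵘ.≃-Reasoning

⊕-identityˡ : ∀ x → zeroQ ⊕ x ≡ x
⊕-identityˡ ⟨ a₁ , a₂ , a₃ , a₄ ⟩ =
  quat-cong (ℚ.+-identityˡ a₁) (ℚ.+-identityˡ a₂) (ℚ.+-identityˡ a₃) (ℚ.+-identityˡ a₄)

⊕-interchange : ∀ x y u v → (x ⊕ y) ⊕ (u ⊕ v) ≡ (x ⊕ u) ⊕ (y ⊕ v)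
⊕-interchange ⟨ a₁ , a₂ , a₃ , a₄ ⟩ ⟨ b₁ , b₂ , b₃ , b₄ ⟩ ⟨ c₁ , c₂ , c₃ , c₄ ⟩ ⟨ d₁ , d₂ , d₃ , d₄ ⟩ =
  quat-cong (+-interchange a₁ b₁ c₁ d₁) (+-interchange a₂ b₂ c₂ d₂)
            (+-interchange a₃ b₃ c₃ d₃) (+-interchange a₄ b₄ c₄ d₄)
  where
  open CommSemigroupProperties (CommutativeMonoid.commutativeSemigroup ℚ.+-0-commutativeMonoid)
    renaming (interchange to +-interchange)

·-zeroˡ : ∀ x → 0ℚ · x ≡ zeroQ
·-zeroˡ ⟨ a₁ , a₂ , a₃ , a₄ ⟩ =
  quat-cong (ℚ.*-zeroˡ a₁) (ℚ.*-zeroˡ a₂) (ℚ.*-zeroˡ a₃) (ℚ.*-zeroˡ a₄)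

·-zeroʳ : ∀ c → c · zeroQ ≡ zeroQ
·-zeroʳ c = quat-cong (ℚ.*-zeroʳ c) (ℚ.*-zeroʳ c) (ℚ.*-zeroʳ c) (ℚ.*-zeroʳ c)

·-assoc : ∀ c d x → c · (d · x) ≡ (c * d) · x
·-assoc c d ⟨ a₁ , a₂ , a₃ , a₄ ⟩ =
  quat-cong (sym (ℚ.*-assoc c d a₁)) (sym (ℚ.*-assoc c d a₂))
            (sym (ℚ.*-assoc c d a₃)) (sym (ℚ.*-assoc c d a₄))

·-distribˡ-⊕ : ∀ c x y → c · (x ⊕ y) ≡ (c · x) ⊕ (c · y)
·-distribˡ-⊕ c ⟨ a₁ , a₂ , a₃ , a₄ ⟩ ⟨ b₁ , b₂ , b₃ , b₄ ⟩ =
  quat-cong (ℚ.*-distribˡ-+ c a₁ b₁) (ℚ.*-distribˡ-+ c a₂ b₂)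
            (ℚ.*-distribˡ-+ c a₃ b₃) (ℚ.*-distribˡ-+ c a₄ b₄)

·-distribʳ-+ : ∀ c d x → (c · x) ⊕ (d · x) ≡ (c + d) · x
·-distribʳ-+ c d ⟨ a₁ , a₂ , a₃ , a₄ ⟩ =
  quat-cong (sym (ℚ.*-distribʳ-+ a₁ c d)) (sym (ℚ.*-distribʳ-+ a₂ c d))
            (sym (ℚ.*-distribʳ-+ a₃ c d)) (sym (ℚ.*-distribʳ-+ a₄ c d))

-- Quaternions with polynomial coordinates, with operations mirroring those of Defs so that
-- ⟦_⟧ᴾ maps them onto ⊕, · and mulQ definitionally; quat-prove then reduces an identity
-- between quaternion expressions to four ring-normal-form checks.
record Quatᴾ (k : ℕ) : Set where
  constructor ⟨_,_,_,_⟩ᴾ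
  field
    p₁ p₂ p₃ p₄ : Polynomial k

module _ {k : ℕ} where

  ⟦_⟧ᴾ : Quatᴾ k → Vec ℚ k → Quat
  ⟦ ⟨ p₁ , p₂ , p₃ , p₄ ⟩ᴾ ⟧ᴾ ρ = ⟨ ⟦ p₁ ⟧ ρ , ⟦ p₂ ⟧ ρ , ⟦ p₃ ⟧ ρ , ⟦ p₄ ⟧ ρ ⟩

  _⊕ᴾ_ : Quatᴾ k → Quatᴾ k → Quatᴾ k
  ⟨ a₁ , a₂ , a₃ , a₄ ⟩ᴾ ⊕ᴾ ⟨ b₁ , b₂ , b₃ , b₄ ⟩ᴾ = ⟨ a₁ :+ b₁ , a₂ :+ b₂ , a₃ :+ b₃ , a₄ :+ b₄ ⟩ᴾ

  _·ᴾ_ : Polynomial k → Quatᴾ k → Quatᴾ k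
  r ·ᴾ ⟨ a₁ , a₂ , a₃ , a₄ ⟩ᴾ = ⟨ r :* a₁ , r :* a₂ , r :* a₃ , r :* a₄ ⟩ᴾ

  mulᴾ : Polynomial k → Polynomial k → Quatᴾ k → Quatᴾ k → Quatᴾ k
  mulᴾ m n ⟨ a₁ , a₂ , a₃ , a₄ ⟩ᴾ ⟨ b₁ , b₂ , b₃ , b₄ ⟩ᴾ =
    ⟨ a₁ :* b₁ :+ m :* (a₂ :* b₂) :+ n :* (a₃ :* b₃) :- (m :* n) :* (a₄ :* b₄)
    , a₁ :* b₂ :+ a₂ :* b₁ :- n :* (a₃ :* b₄) :+ n :* (a₄ :* b₃)
    , a₁ :* b₃ :+ a₃ :* b₁ :+ m :* (a₂ :* b₄) :- m :* (a₄ :* b₂)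
    , a₁ :* b₄ :+ a₄ :* b₁ :+ a₂ :* b₃ :- a₃ :* b₂ ⟩ᴾ

  quat-prove : ∀ ρ (X Y : Quatᴾ k) → let open Quatᴾ in
               ⟦ p₁ X ⟧↓ ρ ≡ ⟦ p₁ Y ⟧↓ ρ → ⟦ p₂ X ⟧↓ ρ ≡ ⟦ p₂ Y ⟧↓ ρ →
               ⟦ p₃ X ⟧↓ ρ ≡ ⟦ p₃ Y ⟧↓ ρ → ⟦ p₄ X ⟧↓ ρ ≡ ⟦ p₄ Y ⟧↓ ρ →
               ⟦ X ⟧ᴾ ρ ≡ ⟦ Y ⟧ᴾ ρ
  quat-prove ρ ⟨ a₁ , a₂ , a₃ , a₄ ⟩ᴾ ⟨ b₁ , b₂ , b₃ , b₄ ⟩ᴾ e₁ e₂ e₃ e₄ =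
    quat-cong (prove ρ a₁ b₁ e₁) (prove ρ a₂ b₂ e₂) (prove ρ a₃ b₃ e₃) (prove ρ a₄ b₄ e₄)

module BilinearityVariables where
  M N C : Polynomial 15
  M = var (# 0)
  N = var (# 1)
  C = var (# 2)

  X Y Z : Quatᴾ 15
  X = ⟨ var (# 3) , var (# 4) , var (# 5) , var (# 6) ⟩ᴾ
  Y = ⟨ var (# 7) , var (# 8) , var (# 9) , var (# 10) ⟩ᴾ
  Z = ⟨ var (# 11) , var (# 12) , var (# 13) , var (# 14) ⟩ᴾ

  env : (m n c : ℚ) (x y z : Quat) → Vec ℚ 15
  env m n c x y z = m ∷ n ∷ c ∷ c₁ x ∷ c₂ x ∷ c₃ x ∷ c₄ x ∷ c₁ y ∷ c₂ y ∷ c₃ y ∷ c₄ y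
                           ∷ c₁ z ∷ c₂ z ∷ c₃ z ∷ c₄ z ∷ []

-1·x⊕x≡0 : ∀ x → ((- 1ℚ) · x) ⊕ x ≡ zeroQ
-1·x⊕x≡0 x = quat-prove (c₁ x ∷ c₂ x ∷ c₃ x ∷ c₄ x ∷ []) ((con (- 1ℚ) ·ᴾ X) ⊕ᴾ X) ⟨ O , O , O , O ⟩ᴾ
                        refl refl refl refl
  where
  O : Polynomial 4
  O = con 0ℚ
  X : Quatᴾ 4
  X = ⟨ var (# 0) , var (# 1) , var (# 2) , var (# 3) ⟩ᴾ

record IsLinear (f : Quat → Quat) : Set where
  field
    map-combination : ∀ c x y → f ((c · x) ⊕ y) ≡ (c · f x) ⊕ f y

  map-zero : f zeroQ ≡ zeroQ
  map-zero = begin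
    f zeroQ                        ≡⟨ cong f (-1·x⊕x≡0 zeroQ) ⟨
    f (((- 1ℚ) · zeroQ) ⊕ zeroQ)   ≡⟨ map-combination (- 1ℚ) zeroQ zeroQ ⟩
    ((- 1ℚ) · f zeroQ) ⊕ f zeroQ   ≡⟨ -1·x⊕x≡0 (f zeroQ) ⟩
    zeroQ                          ∎
    where open ≡-Reasoning

mulQ-linearˡ : ∀ m n c x y z → mulQ m n ((c · x) ⊕ y) z ≡ (c · mulQ m n x z) ⊕ mulQ m n y z
mulQ-linearˡ m n c x y z =
  quat-prove (env m n c x y z) (mulᴾ M N ((C ·ᴾ X) ⊕ᴾ Y) Z) ((C ·ᴾ mulᴾ M N X Z) ⊕ᴾ mulᴾ M N Y Z)
             refl refl refl refl
  where open BilinearityVariables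

mulQ-linearʳ : ∀ m n c x y z → mulQ m n z ((c · x) ⊕ y) ≡ (c · mulQ m n z x) ⊕ mulQ m n z y
mulQ-linearʳ m n c x y z =
  quat-prove (env m n c x y z) (mulᴾ M N Z ((C ·ᴾ X) ⊕ᴾ Y)) ((C ·ᴾ mulᴾ M N Z X) ⊕ᴾ mulᴾ M N Z Y)
             refl refl refl refl
  where open BilinearityVariables

mulQ-isLinearˡ : ∀ m n y → IsLinear (λ x → mulQ m n x y)
mulQ-isLinearˡ m n y = record { map-combination = λ c x x′ → mulQ-linearˡ m n c x x′ y }

mulQ-isLinearʳ : ∀ m n x → IsLinear (mulQ m n x)
mulQ-isLinearʳ m n x = record { map-combination = λ c y y′ → mulQ-linearʳ m n c y y′ x }

AllIn-map : ∀ {P Q : Quat → Set} → (∀ {x} → P x → Q x) → ∀ {k} {gs : Vec Quat k} → AllIn P gs → AllIn Q gs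
AllIn-map f {gs = []}    tt       = tt
AllIn-map f {gs = _ ∷ _} (p , ps) = f p , AllIn-map f ps

zlincomb-replicate-0 : ∀ {k} (hs : Vec Quat k) → zlincomb (replicate k 0ℤ) hs ≡ zeroQ
zlincomb-replicate-0 []       = refl
zlincomb-replicate-0 (h ∷ hs) =
  trans (cong₂ _⊕_ (·-zeroˡ h) (zlincomb-replicate-0 hs)) (⊕-identityˡ zeroQ)

zlincomb-+ : ∀ {k} (zs ys : Vec ℤ k) (hs : Vec Quat k) →
             zlincomb zs hs ⊕ zlincomb ys hs ≡ zlincomb (zipWith ℤ._+_ zs ys) hs
zlincomb-+ []       []       []       = ⊕-identityˡ zeroQ
zlincomb-+ (z ∷ zs) (y ∷ ys) (h ∷ hs) = begin
  ((ι z · h) ⊕ zlincomb zs hs) ⊕ ((ι y · h) ⊕ zlincomb ys hs)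
    ≡⟨ ⊕-interchange (ι z · h) (zlincomb zs hs) (ι y · h) (zlincomb ys hs) ⟩
  ((ι z · h) ⊕ (ι y · h)) ⊕ (zlincomb zs hs ⊕ zlincomb ys hs)
    ≡⟨ cong₂ _⊕_ (·-distribʳ-+ (ι z) (ι y) h) (zlincomb-+ zs ys hs) ⟩
  ((ι z + ι y) · h) ⊕ zlincomb (zipWith ℤ._+_ zs ys) hs
    ≡⟨ cong (λ c → (c · h) ⊕ _) (ι-homo-+ z y) ⟨
  (ι (z ℤ.+ y) · h) ⊕ zlincomb (zipWith ℤ._+_ zs ys) hs
    ∎
  where open ≡-Reasoning

zlincomb-* : ∀ c {k} (zs : Vec ℤ k) (hs : Vec Quat k) →
             ι c · zlincomb zs hs ≡ zlincomb (map (c ℤ.*_) zs) hs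
zlincomb-* c []       []       = ·-zeroʳ (ι c)
zlincomb-* c (z ∷ zs) (h ∷ hs) = begin
  ι c · ((ι z · h) ⊕ zlincomb zs hs)
    ≡⟨ ·-distribˡ-⊕ (ι c) _ _ ⟩
  (ι c · (ι z · h)) ⊕ (ι c · zlincomb zs hs)
    ≡⟨ cong₂ _⊕_ (·-assoc (ι c) (ι z) h) (zlincomb-* c zs hs) ⟩
  ((ι c * ι z) · h) ⊕ zlincomb (map (c ℤ.*_) zs) hs
    ≡⟨ cong (λ d → (d · h) ⊕ _) (ι-homo-* c z) ⟨
  (ι (c ℤ.* z) · h) ⊕ zlincomb (map (c ℤ.*_) zs) hs
    ∎
  where open ≡-Reasoning

module _ {k : ℕ} {gs : Vec Quat k} where

  ZSpan-zero : ZSpan gs zeroQ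
  ZSpan-zero = replicate k 0ℤ , sym (zlincomb-replicate-0 gs)

  ZSpan-⊕ : ∀ {x y} → ZSpan gs x → ZSpan gs y → ZSpan gs (x ⊕ y)
  ZSpan-⊕ (zs , refl) (ys , refl) = zipWith ℤ._+_ zs ys , zlincomb-+ zs ys gs

  ZSpan-· : ∀ c {x} → ZSpan gs x → ZSpan gs (ι c · x)
  ZSpan-· c (zs , refl) = map (c ℤ.*_) zs , zlincomb-* c zs gs

  ZSpan-image : ∀ {f} → IsLinear f → ∀ {j} {hs : Vec Quat j} →
                AllIn (λ h → ZSpan gs (f h)) hs →
                ∀ zs → ZSpan gs (f (zlincomb zs hs))
  ZSpan-image linear {hs = []}    tt       []       = subst (ZSpan gs) (sym map-zero) ZSpan-zero
    where open IsLinear linear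
  ZSpan-image linear {hs = h ∷ hs} (p , ps) (z ∷ zs) =
    subst (ZSpan gs) (sym (map-combination (ι z) h (zlincomb zs hs)))
          (ZSpan-⊕ (ZSpan-· z p) (ZSpan-image linear ps zs))
    where open IsLinear linear

  ZSpan-mulClosed : ∀ m n → AllIn (λ g → AllIn (λ h → ZSpan gs (mulQ m n g h)) gs) gs →
                    ∀ x y → ZSpan gs x → ZSpan gs y → ZSpan gs (mulQ m n x y)
  ZSpan-mulClosed m n table x y (as , refl) (bs , refl) =
    ZSpan-image (mulQ-isLinearˡ m n y)
                (AllIn-map (λ {g} row → ZSpan-image (mulQ-isLinearʳ m n g) row bs) table) as

scaledBasis : ℚ → Vec Quat 4
scaledBasis δ = oneQ ∷ ⟨ 0ℚ , δ , 0ℚ , 0ℚ ⟩ ∷ ⟨ 0ℚ , 0ℚ , 1ℚ , 0ℚ ⟩ ∷ ⟨ 0ℚ , 0ℚ , 0ℚ , 1ℚ ⟩ ∷ []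

lincomb-scaledBasis : ∀ δ a b c d → lincomb (a ∷ b ∷ c ∷ d ∷ []) (scaledBasis δ) ≡ ⟨ a , b * δ , c , d ⟩
lincomb-scaledBasis δ a b c d =
  quat-prove (δ ∷ a ∷ b ∷ c ∷ d ∷ [])
    ((A ·ᴾ ⟨ I , O , O , O ⟩ᴾ) ⊕ᴾ ((B ·ᴾ ⟨ O , Δ , O , O ⟩ᴾ) ⊕ᴾ ((C ·ᴾ ⟨ O , O , I , O ⟩ᴾ) ⊕ᴾ
      ((D ·ᴾ ⟨ O , O , O , I ⟩ᴾ) ⊕ᴾ ⟨ O , O , O , O ⟩ᴾ))))
    ⟨ A , B :* Δ , C , D ⟩ᴾ
    refl refl refl refl
  where
  O I Δ A B C D : Polynomial 5
  O = con 0ℚ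
  I = con 1ℚ
  Δ = var (# 0)
  A = var (# 1)
  B = var (# 2)
  C = var (# 3)
  D = var (# 4)

scaledBasis-spans : ∀ {H : Quat → Set} δ ε → ε * δ ≡ 1ℚ → AllIn H (scaledBasis δ) →
                    ∀ x → Σ ℕ λ k → Σ (Vec Quat k) λ gs → AllIn H gs ×
                            Σ (Vec ℚ k) λ cs → x ≡ lincomb cs gs
scaledBasis-spans δ ε ε*δ≡1 basis⊆H ⟨ a , b , c , d ⟩ =
  4 , scaledBasis δ , basis⊆H , a ∷ b * ε ∷ c ∷ d ∷ [] ,
  sym (trans (lincomb-scaledBasis δ a (b * ε) c d) (cong (λ b′ → ⟨ a , b′ , c , d ⟩) b*ε*δ≡b))
  where
  b*ε*δ≡b : b * ε * δ ≡ b
  b*ε*δ≡b = trans (ℚ.*-assoc b ε δ) (trans (cong (b *_) ε*δ≡1) (ℚ.*-identityʳ b))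

generators : Vec Quat 4
generators = w₁ ∷ w₂ ∷ w₃ ∷ w₄ ∷ []

w-comb : ∀ a b c d → H₂₃₆ (zlincomb (a ∷ b ∷ c ∷ d ∷ []) generators)
w-comb a b c d = a ∷ b ∷ c ∷ d ∷ [] , refl

generator-products : AllIn (λ g → AllIn (λ h → H₂₃₆ (mulQ m₀ n₀ g h)) generators) generators
generator-products =
  ( (w-comb 1ℤ 0ℤ 0ℤ 0ℤ , w-comb 0ℤ 1ℤ 0ℤ 0ℤ , w-comb 0ℤ 0ℤ 1ℤ 0ℤ , w-comb 0ℤ 0ℤ 0ℤ 1ℤ , tt)
  , (w-comb 0ℤ 1ℤ 0ℤ 0ℤ , w-comb -1ℤ 1ℤ 0ℤ 0ℤ , w-comb 0ℤ 0ℤ 0ℤ 1ℤ , w-comb 0ℤ 0ℤ -1ℤ 1ℤ , tt)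
  , (w-comb 0ℤ 0ℤ 1ℤ 0ℤ , w-comb -1ℤ 1ℤ 1ℤ -1ℤ , w-comb -1ℤ 0ℤ 1ℤ 0ℤ , w-comb -1ℤ 1ℤ 0ℤ 0ℤ , tt)
  , (w-comb 0ℤ 0ℤ 0ℤ 1ℤ , w-comb -1ℤ 0ℤ 1ℤ 0ℤ , w-comb 0ℤ -1ℤ 0ℤ 1ℤ , w-comb -1ℤ 0ℤ 0ℤ 0ℤ , tt)
  , tt)

-- î itself is not in H₂₃₆, but 3î = 3w₁ − 3w₂ − 3w₃ + 6w₄ is.
scaledBasis-3⊆H₂₃₆ : AllIn H₂₃₆ (scaledBasis (+ 3 / 1))
scaledBasis-3⊆H₂₃₆ =
    w-comb 1ℤ      0ℤ         0ℤ         0ℤ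
  , w-comb (+ 3)   (ℤ.- + 3)  (ℤ.- + 3)  (+ 6)
  , w-comb -1ℤ     (+ 2)      0ℤ         0ℤ
  , w-comb -1ℤ     -1ℤ        (+ 3)      0ℤ
  , tt

H₂₃₆-mulClosed : ∀ x y → H₂₃₆ x → H₂₃₆ y → H₂₃₆ (mulQ m₀ n₀ x y)
H₂₃₆-mulClosed = ZSpan-mulClosed m₀ n₀ generator-products

lemma18 : (∀ x y → H₂₃₆ x → H₂₃₆ y → H₂₃₆ (mulQ m₀ n₀ x y)) × IsOrder m₀ n₀ H₂₃₆
lemma18 = H₂₃₆-mulClosed , record
  { finitelyGenerated = 4 , generators , λ _ → mk⇔ id id
  ; hasOne            = w-comb 1ℤ 0ℤ 0ℤ 0ℤ
  ; mulClosed         = H₂₃₆-mulClosed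
  ; spansAlgebra      = scaledBasis-spans (+ 3 / 1) (+ 1 / 3) refl scaledBasis-3⊆H₂₃₆
  }
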